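{- Any conventional higher-order logic built on CR is inconsistent; i.e., it proves a contradiction (some proposition $p$ together with $\neg p$, equivalently falsity).
   Context: Combinatory ReFLect (CR) is defined as follows. Types: $\sigma ::= \mathsf{bool} \mid \mathsf{unit} \mid \mathsf{term} \mid \sigma_1 \rightarrow \sigma_2$. Terms: $e ::= \mathsf{I}_\sigma \mid \mathsf{K}_{\sigma,\tau} \mid \mathsf{S}_{\sigma,\tau,\upsilon} \mid \mathsf{value}_\sigma \mid \mathsf{lift} \mid \mathsf{app} \mid e_1\,e_2 \mid \ulcorner e \urcorner$, where $\ulcorner e\urcorner$ is the quotation of $e$. Typing rules: $\mathsf{I}_\sigma : \sigma\to\sigma$; $\mathsf{K}_{\sigma,\tau} : \sigma\to\tau\to\sigma$; $\mathsf{S}_{\sigma,\tau,\upsilon} : (\sigma\to\tau\to\upsilon)\to(\sigma\to\tau)\to\sigma\to\upsilon$; $\mathsf{value}_\sigma : \mathsf{term}\to\sigma$; $\mathsf{lift} : \mathsf{term}\to\mathsf{term}$; $\mathsf{app} : \mathsf{term}\to\mathsf{term}\to\mathsf{term}$; if $e_1 : \sigma\to\tau$ and $e_2:\sigma$ then $e_1\,e_2 : \tau$; if $e:\sigma$ then $\ulcorner e\urcorner : \mathsf{term}$. Basic reduction rules: $\mathsf{I}_\sigma\, e \to e$; $\mathsf{K}_{\sigma,\tau}\, e_1\, e_2 \to e_1$; $\mathsf{S}_{\sigma,\tau,\upsilon}\, e_1\, e_2\, e_3 \to e_1\, e_3\, (e_2\, e_3)$; if $e:\sigma$ then $\mathsf{value}_\sigma\,\ulcorner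 e\urcorner \to e$; $\mathsf{lift}\,\ulcorner s\urcorner \to \ulcorner\ulcorner s\urcorner\urcorner$; if $e_1\,e_2$ is well typed then $\mathsf{app}\,\ulcorner e_1\urcorner\,\ulcorner e_2\urcorner \to \ulcorner e_1\,e_2\urcorner$; the reduction relation $\Rightarrow$ is the closure of these under reflexivity, transitivity and congruence. A "conventional higher-order logic built on CR" is a classical logic in the style of Church's simple theory of types / the HOL logic whose terms are CR terms extended with the usual logical constants (in particular negation $\neg : \mathsf{bool}\to\mathsf{bool}$ with its standard classical meaning), with an equality $=$ between terms of the same type, such that: $\vdash e_1 = e_2$ holds whenever $e_1 \Rightarrow e_2$ for well-typed $e_1,e_2$; and provable equality is reflexive, symmetric, transitive and a congruence with respect to application. -}

module Defs where

open import Data.List using (List; []; _∷_)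
open import Data.List.Membership.Propositional using (_∈_)
open import Data.Product using (Σ; _×_)

infixr 20 _⇒_
data Ty : Set where
  bool unit term : Ty
  _⇒_ : Ty → Ty → Ty

-- They are the CR terms (I, K, S, value, lift, app, application,
-- quotation) extended with the logical constants: negation, the
-- equality constant at every type, and an arbitrary further family
-- of constants C (the remaining "usual logical constants").
infixl 30 _·_
data Tm (C : Ty → Set) : Ty → Set where
  I     : ∀ {σ} → Tm C (σ ⇒ σ)
  K     : ∀ {σ τ} → Tm C (σ ⇒ τ ⇒ σ)
  S     : ∀ {σ τ υ} → Tm C ((σ ⇒ τ ⇒ υ) ⇒ (σ ⇒ τ) ⇒ σ ⇒ υ)
  value : ∀ {σ} → Tm C (term ⇒ σ)
  lift  : Tm C (term ⇒ term)
  app   : Tm C (term ⇒ term ⇒ term)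
  _·_   : ∀ {σ τ} → Tm C (σ ⇒ τ) → Tm C σ → Tm C τ
  ⌜_⌝   : ∀ {σ} → Tm C σ → Tm C term
  neg   : Tm C (bool ⇒ bool)
  eq    : ∀ {σ} → Tm C (σ ⇒ σ ⇒ bool)
  con   : ∀ {σ} → C σ → Tm C σ

-- One-step basic reductions of CR (typing side conditions are
-- enforced by intrinsic typing).
data _↦_ {C : Ty → Set} : ∀ {σ} → Tm C σ → Tm C σ → Set where
  I-red     : ∀ {σ} (e : Tm C σ) → I · e ↦ e
  K-red     : ∀ {σ τ} (e₁ : Tm C σ) (e₂ : Tm C τ) → K · e₁ · e₂ ↦ e₁
  S-red     : ∀ {σ τ υ} (e₁ : Tm C (σ ⇒ τ ⇒ υ)) (e₂ : Tm C (σ ⇒ τ)) (e₃ : Tm C σ) →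
              S · e₁ · e₂ · e₃ ↦ e₁ · e₃ · (e₂ · e₃)
  value-red : ∀ {σ} (e : Tm C σ) → value · ⌜ e ⌝ ↦ e
  lift-red  : ∀ {σ} (s : Tm C σ) → lift · ⌜ s ⌝ ↦ ⌜ ⌜ s ⌝ ⌝
  app-red   : ∀ {σ τ} (e₁ : Tm C (σ ⇒ τ)) (e₂ : Tm C σ) →
              app · ⌜ e₁ ⌝ · ⌜ e₂ ⌝ ↦ ⌜ e₁ · e₂ ⌝

data _⟹_ {C : Ty → Set} : ∀ {σ} → Tm C σ → Tm C σ → Set where
  step   : ∀ {σ} {e₁ e₂ : Tm C σ} → e₁ ↦ e₂ → e₁ ⟹ e₂
  refl⟹  : ∀ {σ} {e : Tm C σ} → e ⟹ e
  trans⟹ : ∀ {σ} {e₁ e₂ e₃ : Tm C σ} → e₁ ⟹ e₂ → e₂ ⟹ e₃ → e₁ ⟹ e₃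
  cong⟹  : ∀ {σ τ} {f g : Tm C (σ ⇒ τ)} {a b : Tm C σ} →
           f ⟹ g → a ⟹ b → f · a ⟹ g · b

infix 15 _≐_
_≐_ : ∀ {C σ} → Tm C σ → Tm C σ → Tm C bool
a ≐ b = eq · a · b

¬′_ : ∀ {C} → Tm C bool → Tm C bool
¬′ p = neg · p

record ConventionalHOL (C : Ty → Set) : Set₁ where
  field
    _⊢_     : List (Tm C bool) → Tm C bool → Set
    assume  : ∀ {Γ p} → p ∈ Γ → Γ ⊢ p
    red     : ∀ {Γ σ} {e₁ e₂ : Tm C σ} → e₁ ⟹ e₂ → Γ ⊢ (e₁ ≐ e₂)
    ≐-refl  : ∀ {Γ σ} (e : Tm C σ) → Γ ⊢ (e ≐ e)
    ≐-sym   : ∀ {Γ σ} {e₁ e₂ : Tm C σ} → Γ ⊢ (e₁ ≐ e₂) → Γ ⊢ (e₂ ≐ e₁)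
    ≐-trans : ∀ {Γ σ} {e₁ e₂ e₃ : Tm C σ} →
              Γ ⊢ (e₁ ≐ e₂) → Γ ⊢ (e₂ ≐ e₃) → Γ ⊢ (e₁ ≐ e₃)
    ≐-cong  : ∀ {Γ σ τ} {f g : Tm C (σ ⇒ τ)} {a b : Tm C σ} →
              Γ ⊢ (f ≐ g) → Γ ⊢ (a ≐ b) → Γ ⊢ (f · a ≐ g · b)
    -- equality of propositions is material (EQ_MP, as in HOL)
    eq-mp   : ∀ {Γ p q} → Γ ⊢ (p ≐ q) → Γ ⊢ p → Γ ⊢ q
    ¬-intro : ∀ {Γ p q} → (p ∷ Γ) ⊢ q → (p ∷ Γ) ⊢ (¬′ q) → Γ ⊢ (¬′ p)
    ¬¬-elim : ∀ {Γ p} → Γ ⊢ (¬′ (¬′ p)) → Γ ⊢ p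

Inconsistent : ∀ {C} → ConventionalHOL C → Set
Inconsistent {C} L = Σ (Tm C bool) λ p → ([] ⊢ p) × ([] ⊢ (¬′ p))
  where open ConventionalHOL L

module Submission where

open import Data.List using ([])
open import Data.List.Relation.Unary.Any using (here)
open import Data.Product using (_,_)
open import Relation.Binary.PropositionalEquality using (refl)

open import Defs

-- The quotation combinators let a term apply a quoted
-- function to its own quotation: diag ⌜ e ⌝ reduces to e ⌜ e ⌝, so, as in
-- the diagonal lemma, every f : σ → σ has a fixed point fix f ⟹ f (fix f).
-- For f = ¬ this is a proposition p with ⊢ p = ¬ p, and the classical
-- rules for negation then prove both ¬ p and p.

module _ {C : Ty → Set} where

  diag : ∀ {σ} → Tm C (term ⇒ σ)
  diag = S · (K · value) · (S · app · lift)

  quote-self-app-⟹ : ∀ {σ} (e : Tm C (term ⇒ σ)) →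
                     S · app · lift · ⌜ e ⌝ ⟹ ⌜ e · ⌜ e ⌝ ⌝
  quote-self-app-⟹ e =
    trans⟹ (step (S-red app lift ⌜ e ⌝))
      (trans⟹ (cong⟹ refl⟹ (step (lift-red e))) (step (app-red e ⌜ e ⌝)))

  diag-⟹ : ∀ {σ} (e : Tm C (term ⇒ σ)) → diag · ⌜ e ⌝ ⟹ e · ⌜ e ⌝
  diag-⟹ e =
    trans⟹ (step (S-red (K · value) (S · app · lift) ⌜ e ⌝))
      (trans⟹ (cong⟹ (step (K-red value ⌜ e ⌝)) (quote-self-app-⟹ e))
        (step (value-red (e · ⌜ e ⌝))))

  fix : ∀ {σ} → Tm C (σ ⇒ σ) → Tm C σ
  fix f = S · (K · f) · diag · ⌜ S · (K · f) · diag ⌝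

  fix-⟹ : ∀ {σ} (f : Tm C (σ ⇒ σ)) → fix f ⟹ f · fix f
  fix-⟹ {σ} f =
    trans⟹ (step (S-red (K · f) diag ⌜ d ⌝))
      (cong⟹ (step (K-red f ⌜ d ⌝)) (diag-⟹ d))
    where
    d : Tm C (term ⇒ σ)
    d = S · (K · f) · diag

-- The equation is needed under the extra hypothesis p, and the logic has no
-- weakening rule; red provides it in every context.
liar⇒inconsistent : ∀ {C} (L : ConventionalHOL C) {p : Tm C bool} →
                    (∀ {Γ} → ConventionalHOL._⊢_ L Γ (p ≐ ¬′ p)) → Inconsistent L
liar⇒inconsistent L {p} p≐¬p = p , ⊢p , ⊢¬p
  where
  open ConventionalHOL L
  ⊢¬p : [] ⊢ (¬′ p)
  ⊢¬p = ¬-intro (assume (here refl)) (eq-mp p≐¬p (assume (here refl)))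
  ⊢p : [] ⊢ p
  ⊢p = eq-mp (≐-sym p≐¬p) ⊢¬p

corollary1 : (C : Ty → Set) (L : ConventionalHOL C) → Inconsistent L
corollary1 C L = liar⇒inconsistent L (red (fix-⟹ neg))
  where open ConventionalHOL L
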